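{- Let $p$ be a prime and $m\in\mathbb N$ with $p\nmid m$. Write $\Phi_{mp}(z)=\sum_{k=0}^{(p-1)\varphi(m)}a_{mp}(k)z^{(p-1)\varphi(m)-k}$ and $\Phi_m(z)=\sum_{s=0}^{\varphi(m)}a_m(s)z^{\varphi(m)-s}$. Then for every $k\in\{0,1,\ldots,(p-1)\varphi(m)\}$, $$a_{mp}(k)=\sum_{s=0}^{[k/p]}a_m(s)\,\mathcal H_{k-sp}(\vec\zeta_m^{\,*}).$$
   Context: $\Phi_n(z)=\prod_{1\le j\le n,\ (j,n)=1}(z-\zeta_n^j)$ with $\zeta_n=e^{2\pi i/n}$ is the $n$th cyclotomic polynomial; $\varphi$ is Euler's totient function and $[x]$ is the integer part of $x$. For $r\in\mathbb N_0$, $\mathcal H_r(z_1,\ldots,z_n)=\sum_{r_1+\cdots+r_n=r,\ r_i\in\mathbb N_0}z_1^{r_1}\cdots z_n^{r_n}$ is the complete homogeneous symmetric polynomial of degree $r$ (with $\mathcal H_0=1$). $\mathcal H_r(\vec\zeta_m^{\,*})$ denotes $\mathcal H_r$ evaluated at the $\varphi(m)$ primitive $m$th roots of unity $\zeta_m^j$, $1\le j\le m$, $(j,m)=1$. -}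

module Defs where

open import Level using (Level)
open import Data.Nat as ℕ using (ℕ; zero; suc; _∸_; _≤_; _<_)
open import Data.Nat.Coprimality using (coprime?)
open import Data.List using (List; []; _∷_; map; filter; upTo; length; foldr)
open import Data.Product using (∃)
open import Relation.Nullary using (¬_)
open import Algebra.Bundles using (CommutativeRing)

coprimeIdx : ℕ → List ℕ
coprimeIdx n = filter (λ j → coprime? j n) (map suc (upTo n))

φ : ℕ → ℕ
φ n = length (coprimeIdx n)

module Cyc {c ℓ : Level} (R : CommutativeRing c ℓ) where
  open CommutativeRing R

  pow : Carrier → ℕ → Carrier
  pow x zero    = 1#
  pow x (suc n) = x * pow x n

  natMul : ℕ → Carrier
  natMul zero    = 0#
  natMul (suc n) = 1# + natMul n

  -- R is a field of characteristic zero (the role played by ℂ)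
  record IsCharZeroField : Set (c Level.⊔ ℓ) where
    field
      1≉0     : ¬ (1# ≈ 0#)
      inverse : ∀ x → ¬ (x ≈ 0#) → ∃ λ y → x * y ≈ 1#
      char0   : ∀ n → ¬ (natMul (suc n) ≈ 0#)

  record IsPrimitiveRoot (n : ℕ) (ω : Carrier) : Set ℓ where
    field
      pow-n≈1  : pow ω n ≈ 1#
      pow-d≉1  : ∀ d → 1 ≤ d → d < n → ¬ (pow ω d ≈ 1#)

  -- Polynomials: coefficient lists in ascending degree
  Poly : Set c
  Poly = List Carrier

  _+P_ : Poly → Poly → Poly
  []       +P q        = q
  (a ∷ p)  +P []       = a ∷ p
  (a ∷ p)  +P (b ∷ q)  = (a + b) ∷ (p +P q)

  scale : Carrier → Poly → Poly
  scale a = map (a *_)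

  _*P_ : Poly → Poly → Poly
  []      *P q = []
  (a ∷ p) *P q = scale a q +P (0# ∷ (p *P q))

  prodP : List Poly → Poly
  prodP = foldr _*P_ (1# ∷ [])

  coeff : Poly → ℕ → Carrier
  coeff []      _       = 0#
  coeff (a ∷ p) zero    = a
  coeff (a ∷ p) (suc i) = coeff p i

  lin : Carrier → Poly
  lin r = (- r) ∷ 1# ∷ []

  primRoots : ℕ → Carrier → List Carrier
  primRoots n ζ = map (pow ζ) (coprimeIdx n)

  cyclo : ℕ → Carrier → Poly
  cyclo n ζ = prodP (map lin (primRoots n ζ))

  a : ℕ → Carrier → ℕ → Carrier
  a n ζ k = coeff (cyclo n ζ) (φ n ∸ k)

  sumTo : ℕ → (ℕ → Carrier) → Carrier
  sumTo zero    f = f 0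
  sumTo (suc N) f = sumTo N f + f (suc N)

  -- complete homogeneous symmetric polynomial H_r(z_1,…,z_n):
  -- H_r() = [r = 0],  H_r(z ∷ zs) = Σ_{i=0}^{r} z^i H_{r−i}(zs)
  H : ℕ → List Carrier → Carrier
  H zero    []       = 1#
  H (suc r) []       = 0#
  H r       (z ∷ zs) = sumTo r (λ i → pow z i * H (r ∸ i) zs)

-- Let P_n(z) = ∏ (1 − ζ z) over the primitive n-th roots ζ, the reversal of Φ_n: then a_n(k)
-- is the coefficient of z^k in P_n, and Σ_r H_r(ζ⃗_m*) z^r = 1 / P_m(z) as formal power series.
-- As p ∤ m, the j ≤ mp with (j, m) = 1 are those with (j, mp) = 1 together with the multiples
-- p j′ with j′ ≤ m, (j′, m) = 1. Grouped instead by their residue i mod m they are the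
-- i + t m, t < p, and ∏_{t<p} (1 − x η^t z) = 1 − x^p z^p for η = ω^m of order p (the product is
-- invariant under z ↦ η z). Hence P_mp(z) P_m(z) = P_m(z^p), so P_mp(z) = P_m(z^p) Σ_r H_r(ζ⃗_m*) z^r,
-- and comparing coefficients of z^k gives the formula.

module Submission where

open import Level using (Level)
open import Function.Base using (_∘_)
open import Data.Empty using (⊥-elim)
open import Data.Product using (_,_; proj₁; proj₂; swap)
open import Data.Sum using (inj₁; inj₂)
open import Data.Nat as ℕ using (ℕ; zero; suc; _∸_; _≤_; _<_; z≤n; s≤s; NonZero; _/_; _%_)
import Data.Nat.Properties as ℕ
open import Data.Nat.DivMod using (m≡m%n+[m/n]*n; m%n<n; m*n/n≡m; m/n*n≡m; m/n*n≤m; m≥n⇒m/n>0; /-monoˡ-≤)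
open import Data.Nat.Divisibility
  using (_∣_; _∣?_; n∣m*n; ∣⇒≤; ∣m+n∣m⇒∣n; ∣m∸n∣n⇒∣m; ∣m∣n⇒∣m+n; ∣n⇒∣m*n; ∣m⇒∣m*n; ∣-refl; ∣-trans)
open import Data.Nat.Coprimality using (Coprime; coprime?; coprime-divisor)
open import Data.Nat.Primality using (Prime; prime⇒irreducible; prime⇒nonTrivial; prime⇒nonZero)
open import Data.List using (List; []; _∷_; _++_; _∷ʳ_; map; foldr; length; applyUpTo; upTo; filter)
import Data.List.Properties as List
open import Data.List.Relation.Unary.All using (All)
import Data.List.Relation.Unary.All.Properties as All
open import Data.List.Relation.Binary.Pointwise as Pointwise using (Pointwise; []; _∷_)
import Data.List.Relation.Binary.Permutation.Setoid as SetoidPermutation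
import Data.List.Relation.Binary.Permutation.Setoid.Properties as SetoidPermutationProperties
open import Relation.Nullary using (¬_; yes; no)
open import Relation.Unary using (Pred; Decidable; ∁; _∩_; _≐_)
open import Relation.Unary.Properties using (_∩?_; ∁?)
open import Relation.Binary.Bundles using (Setoid)
open import Relation.Binary.Definitions using (tri<; tri≈; tri>)
open import Relation.Binary.PropositionalEquality as ≡ using (_≡_)
import Relation.Binary.Reasoning.Setoid as ≈-Reasoning
open import Algebra.Bundles using (CommutativeRing; CommutativeMonoid)
open import Algebra.Structures.Biased using (isCommutativeMonoidˡ)
import Algebra.Properties.CommutativeSemigroup as CommSemigroupProperties
import Algebra.Properties.Semiring.Exp as SemiringExp
import Algebra.Properties.Ring as RingProperties
import Algebra.Properties.Group as GroupProperties
open import Defs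

module _ {a : Level} {A : Set a} where

  filter-filter : ∀ {p q} {P : Pred A p} {Q : Pred A q} (P? : Decidable P) (Q? : Decidable Q) xs →
                  filter P? (filter Q? xs) ≡ filter (Q? ∩? P?) xs
  filter-filter P? Q? []       = ≡.refl
  filter-filter P? Q? (x ∷ xs) with Q? x
  ... | no  _ = filter-filter P? Q? xs
  ... | yes _ with P? x
  ...   | yes _ = ≡.cong (x ∷_) (filter-filter P? Q? xs)
  ...   | no  _ = filter-filter P? Q? xs

  filter-map : ∀ {b p q} {B : Set b} {P : Pred B p} {Q : Pred A q} (P? : Decidable P) (Q? : Decidable Q) (f : A → B) →
               P ∘ f ≐ Q → ∀ xs → filter P? (map f xs) ≡ map f (filter Q? xs)
  filter-map P? Q? f P∘f≐Q []       = ≡.refl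
  filter-map P? Q? f P∘f≐Q (x ∷ xs) with P? (f x) | Q? x
  ... | yes _   | yes _   = ≡.cong (f x ∷_) (filter-map P? Q? f P∘f≐Q xs)
  ... | no  _   | no  _   = filter-map P? Q? f P∘f≐Q xs
  ... | yes Pfx | no ¬Qx  = ⊥-elim (¬Qx (proj₁ P∘f≐Q Pfx))
  ... | no ¬Pfx | yes Qx  = ⊥-elim (¬Pfx (proj₂ P∘f≐Q Qx))

  applyUpTo-pointwise : ∀ {b r} {B : Set b} {_∼_ : A → B → Set r} {f : ℕ → A} {g : ℕ → B} →
               (∀ i → f i ∼ g i) → ∀ n → Pointwise _∼_ (applyUpTo f n) (applyUpTo g n)
  applyUpTo-pointwise f∼g zero    = []
  applyUpTo-pointwise f∼g (suc n) = f∼g 0 ∷ applyUpTo-pointwise (f∼g ∘ suc) n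

  map-pointwise : ∀ {b c r} {B : Set b} {C : Set c} {_∼_ : B → C → Set r} {f : A → B} {g : A → C} →
         (∀ x → f x ∼ g x) → ∀ xs → Pointwise _∼_ (map f xs) (map g xs)
  map-pointwise f∼g []       = []
  map-pointwise f∼g (x ∷ xs) = f∼g x ∷ map-pointwise f∼g xs

  applyUpTo-++ : ∀ (f : ℕ → A) m n → applyUpTo f (m ℕ.+ n) ≡ applyUpTo f m ++ applyUpTo (f ∘ (m ℕ.+_)) n
  applyUpTo-++ f zero    n = ≡.refl
  applyUpTo-++ f (suc m) n = ≡.cong (f 0 ∷_) (applyUpTo-++ (f ∘ suc) m n)

module ListProduct {c ℓ : Level} (M : CommutativeMonoid c ℓ) where
  open CommutativeMonoid M
  open CommSemigroupProperties commutativeSemigroup using (interchange)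
  open SetoidPermutation setoid using (_↭_)
  open ≈-Reasoning setoid

  ∏ : List Carrier → Carrier
  ∏ = foldr _∙_ ε

  ∏-++ : ∀ xs ys → ∏ (xs ++ ys) ≈ ∏ xs ∙ ∏ ys
  ∏-++ []       ys = sym (identityˡ (∏ ys))
  ∏-++ (x ∷ xs) ys = trans (∙-congˡ (∏-++ xs ys)) (sym (assoc x (∏ xs) (∏ ys)))

  ∏-∷ʳ : ∀ xs x → ∏ (xs ∷ʳ x) ≈ ∏ xs ∙ x
  ∏-∷ʳ xs x = trans (∏-++ xs (x ∷ [])) (∙-congˡ (identityʳ x))

  ∏-↭ : ∀ {xs ys} → xs ↭ ys → ∏ xs ≈ ∏ ys
  ∏-↭ = SetoidPermutationProperties.foldr-commMonoid setoid isCommutativeMonoid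

  module _ {a} {A : Set a} where

    ∏-map-cong : ∀ {f g : A → Carrier} → (∀ i → f i ≈ g i) → ∀ is → ∏ (map f is) ≈ ∏ (map g is)
    ∏-map-cong f≈g []       = refl
    ∏-map-cong f≈g (i ∷ is) = ∙-cong (f≈g i) (∏-map-cong f≈g is)

    ∏-map-ε : ∀ is → ∏ (map (λ (_ : A) → ε) is) ≈ ε
    ∏-map-ε []       = refl
    ∏-map-ε (i ∷ is) = trans (identityˡ _) (∏-map-ε is)

    ∏-map-∙ : ∀ (f g : A → Carrier) is → ∏ (map (λ i → f i ∙ g i) is) ≈ ∏ (map f is) ∙ ∏ (map g is)
    ∏-map-∙ f g []       = sym (identityˡ ε)
    ∏-map-∙ f g (i ∷ is) = begin
      (f i ∙ g i) ∙ ∏ (map (λ i → f i ∙ g i) is)      ≈⟨ ∙-congˡ (∏-map-∙ f g is) ⟩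
      (f i ∙ g i) ∙ (∏ (map f is) ∙ ∏ (map g is))      ≈⟨ interchange (f i) (g i) _ _ ⟩
      (f i ∙ ∏ (map f is)) ∙ (g i ∙ ∏ (map g is))      ∎

  ∏-homo : ∀ (h : Carrier → Carrier) → h ε ≈ ε → (∀ x y → h (x ∙ y) ≈ h x ∙ h y) →
           ∀ xs → h (∏ xs) ≈ ∏ (map h xs)
  ∏-homo h h-ε h-∙ []       = h-ε
  ∏-homo h h-ε h-∙ (x ∷ xs) = trans (h-∙ x (∏ xs)) (∙-congˡ (∏-homo h h-ε h-∙ xs))

module FiniteSums {c ℓ : Level} (R : CommutativeRing c ℓ) where
  open CommutativeRing R
  open Cyc R using (sumTo)
  open CommSemigroupProperties +-commutativeSemigroup using (interchange)
  open ≈-Reasoning setoid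

  sumTo-cong : ∀ N {f g : ℕ → Carrier} → (∀ i → i ≤ N → f i ≈ g i) → sumTo N f ≈ sumTo N g
  sumTo-cong zero    f≈g = f≈g 0 z≤n
  sumTo-cong (suc N) f≈g = +-cong (sumTo-cong N (λ i i≤N → f≈g i (ℕ.m≤n⇒m≤1+n i≤N))) (f≈g (suc N) ℕ.≤-refl)

  sumTo-unfoldˡ : ∀ N f → sumTo (suc N) f ≈ f 0 + sumTo N (f ∘ suc)
  sumTo-unfoldˡ zero    f = refl
  sumTo-unfoldˡ (suc N) f = trans (+-congʳ (sumTo-unfoldˡ N f)) (+-assoc _ _ _)

  sumTo-zero : ∀ N {f : ℕ → Carrier} → (∀ i → i ≤ N → f i ≈ 0#) → sumTo N f ≈ 0#
  sumTo-zero N f≈0 = trans (sumTo-cong N f≈0) (sumTo-0# N)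
    where
    sumTo-0# : ∀ N → sumTo N (λ _ → 0#) ≈ 0#
    sumTo-0# zero    = refl
    sumTo-0# (suc N) = trans (+-congʳ (sumTo-0# N)) (+-identityˡ 0#)

  sumTo-+ : ∀ N f g → sumTo N (λ i → f i + g i) ≈ sumTo N f + sumTo N g
  sumTo-+ zero    f g = refl
  sumTo-+ (suc N) f g = trans (+-congʳ (sumTo-+ N f g)) (interchange _ _ _ _)

  sumTo-*ˡ : ∀ N a f → sumTo N (λ i → a * f i) ≈ a * sumTo N f
  sumTo-*ˡ zero    a f = refl
  sumTo-*ˡ (suc N) a f = trans (+-congʳ (sumTo-*ˡ N a f)) (sym (distribˡ a _ _))

  sumTo-*ʳ : ∀ N a f → sumTo N (λ i → f i * a) ≈ sumTo N f * a
  sumTo-*ʳ N a f = begin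
    sumTo N (λ i → f i * a) ≈⟨ sumTo-cong N (λ i _ → *-comm (f i) a) ⟩
    sumTo N (λ i → a * f i) ≈⟨ sumTo-*ˡ N a f ⟩
    a * sumTo N f           ≈⟨ *-comm a _ ⟩
    sumTo N f * a           ∎

  sumTo-reverse : ∀ N f → sumTo N f ≈ sumTo N (λ i → f (N ∸ i))
  sumTo-reverse zero    f = refl
  sumTo-reverse (suc N) f = begin
    sumTo N f + f (suc N)                         ≈⟨ +-congʳ (sumTo-reverse N f) ⟩
    sumTo N (λ i → f (N ∸ i)) + f (suc N)         ≈⟨ +-comm _ _ ⟩
    f (suc N) + sumTo N (λ i → f (N ∸ i))         ≈⟨ sumTo-unfoldˡ N (λ i → f (suc N ∸ i)) ⟨
    sumTo (suc N) (λ i → f (suc N ∸ i))           ∎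

  sumTo-triangle : ∀ n (F : ℕ → ℕ → Carrier) →
    sumTo n (λ k → sumTo k (λ i → F i k)) ≈ sumTo n (λ i → sumTo (n ∸ i) (λ j → F i (i ℕ.+ j)))
  sumTo-triangle zero    F = refl
  sumTo-triangle (suc n) F = begin
    sumTo n (λ k → sumTo k (λ i → F i k)) + (sumTo n (λ i → F i (suc n)) + F (suc n) (suc n))
      ≈⟨ +-congʳ (sumTo-triangle n F) ⟩
    sumTo n rows + (sumTo n (λ i → F i (suc n)) + F (suc n) (suc n))
      ≈⟨ +-assoc _ _ _ ⟨
    (sumTo n rows + sumTo n (λ i → F i (suc n))) + F (suc n) (suc n)
      ≈⟨ +-cong (sumTo-+ n rows _) (reflexive (≡.cong (F (suc n)) (ℕ.+-identityʳ (suc n)))) ⟨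
    sumTo n (λ i → rows i + F i (suc n)) + F (suc n) (suc n ℕ.+ 0)
      ≈⟨ +-cong (sumTo-cong n extend-row) (reflexive (≡.cong (λ z → sumTo z (λ j → F (suc n) (suc n ℕ.+ j))) (≡.sym (ℕ.n∸n≡0 n)))) ⟩
    sumTo n (λ i → sumTo (suc n ∸ i) (λ j → F i (i ℕ.+ j))) + sumTo (suc n ∸ suc n) (λ j → F (suc n) (suc n ℕ.+ j))
      ∎
    where
    rows : ℕ → Carrier
    rows i = sumTo (n ∸ i) (λ j → F i (i ℕ.+ j))
    extend-row : ∀ i → i ≤ n → rows i + F i (suc n) ≈ sumTo (suc n ∸ i) (λ j → F i (i ℕ.+ j))
    extend-row i i≤n rewrite ℕ.+-∸-assoc 1 i≤n =
      +-congˡ (reflexive (≡.cong (F i) (≡.sym (≡.trans (ℕ.+-suc i (n ∸ i)) (≡.cong suc (ℕ.m+[n∸m]≡n i≤n))))))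

module PowerSeries {c ℓ : Level} (R : CommutativeRing c ℓ) where
  open CommutativeRing R
  open Cyc R using (pow; sumTo; H)
  open FiniteSums R
  open SetoidPermutation setoid using () renaming (_↭_ to _↭ᴿ_)

  Series : Set c
  Series = ℕ → Carrier

  infix 4 _≋_
  record _≋_ (f g : Series) : Set ℓ where
    constructor coeffwise
    field coeff-≈ : ∀ n → f n ≈ g n
  open _≋_ public

  infixl 7 _⋆_
  _⋆_ : Series → Series → Series
  (f ⋆ g) n = sumTo n (λ i → f i * g (n ∸ i))

  𝟙 : Series
  𝟙 zero    = 1#
  𝟙 (suc n) = 0#

  ≋-setoid : Setoid c ℓ
  ≋-setoid = record
    { Carrier       = Series
    ; _≈_           = _≋_
    ; isEquivalence = record
      { refl  = coeffwise λ n → refl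
      ; sym   = λ f≋g → coeffwise λ n → sym (f≋g .coeff-≈ n)
      ; trans = λ f≋g g≋h → coeffwise λ n → trans (f≋g .coeff-≈ n) (g≋h .coeff-≈ n)
      }
    }

  ⋆-cong : ∀ {f f′ g g′} → f ≋ f′ → g ≋ g′ → f ⋆ g ≋ f′ ⋆ g′
  ⋆-cong f≋f′ g≋g′ = coeffwise λ n → sumTo-cong n (λ i _ → *-cong (f≋f′ .coeff-≈ i) (g≋g′ .coeff-≈ (n ∸ i)))

  ⋆-comm : ∀ f g → f ⋆ g ≋ g ⋆ f
  ⋆-comm f g = coeffwise λ n → begin
    sumTo n (λ i → f i * g (n ∸ i))
      ≈⟨ sumTo-reverse n _ ⟩
    sumTo n (λ i → f (n ∸ i) * g (n ∸ (n ∸ i)))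
      ≈⟨ sumTo-cong n (λ i i≤n → trans (*-comm _ _) (*-congʳ (reflexive (≡.cong g (ℕ.m∸[m∸n]≡n i≤n))))) ⟩
    sumTo n (λ i → g i * f (n ∸ i))
      ∎
    where open ≈-Reasoning setoid

  ⋆-assoc : ∀ f g h → (f ⋆ g) ⋆ h ≋ f ⋆ (g ⋆ h)
  ⋆-assoc f g h = coeffwise λ n → begin
    sumTo n (λ k → sumTo k (λ i → f i * g (k ∸ i)) * h (n ∸ k))
      ≈⟨ sumTo-cong n (λ k _ → sumTo-*ʳ k (h (n ∸ k)) _) ⟨
    sumTo n (λ k → sumTo k (λ i → f i * g (k ∸ i) * h (n ∸ k)))
      ≈⟨ sumTo-triangle n (λ i k → f i * g (k ∸ i) * h (n ∸ k)) ⟩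
    sumTo n (λ i → sumTo (n ∸ i) (λ j → f i * g (i ℕ.+ j ∸ i) * h (n ∸ (i ℕ.+ j))))
      ≈⟨ sumTo-cong n (λ i _ → trans (sumTo-cong (n ∸ i) (λ j _ → reassociate n i j)) (sumTo-*ˡ (n ∸ i) (f i) _)) ⟩
    sumTo n (λ i → f i * sumTo (n ∸ i) (λ j → g j * h (n ∸ i ∸ j)))
      ∎
    where
    open ≈-Reasoning setoid
    reassociate : ∀ n i j → f i * g (i ℕ.+ j ∸ i) * h (n ∸ (i ℕ.+ j)) ≈ f i * (g j * h (n ∸ i ∸ j))
    reassociate n i j rewrite ℕ.m+n∸m≡n i j | ℕ.∸-+-assoc n i j = *-assoc _ _ _

  ⋆-identityˡ : ∀ g → 𝟙 ⋆ g ≋ g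
  ⋆-identityˡ g = coeffwise coeff
    where
    open ≈-Reasoning setoid
    coeff : ∀ n → (𝟙 ⋆ g) n ≈ g n
    coeff zero    = *-identityˡ (g 0)
    coeff (suc n) = begin
      (𝟙 ⋆ g) (suc n)                                      ≈⟨ sumTo-unfoldˡ n _ ⟩
      1# * g (suc n) + sumTo n (λ i → 0# * g (n ∸ i))      ≈⟨ +-cong (*-identityˡ _) (sumTo-zero n (λ i _ → zeroˡ _)) ⟩
      g (suc n) + 0#                                       ≈⟨ +-identityʳ _ ⟩
      g (suc n)                                            ∎

  ⋆-commutativeMonoid : CommutativeMonoid c ℓ
  ⋆-commutativeMonoid = record
    { isCommutativeMonoid = isCommutativeMonoidˡ record
      { isSemigroup = record
        { isMagma = record { isEquivalence = Setoid.isEquivalence ≋-setoid ; ∙-cong = ⋆-cong }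
        ; assoc   = ⋆-assoc
        }
      ; identityˡ = ⋆-identityˡ
      ; comm      = ⋆-comm
      }
    }

  open CommutativeMonoid ⋆-commutativeMonoid public
    using () renaming ( refl to ≋-refl; sym to ≋-sym; trans to ≋-trans; reflexive to ≋-reflexive
                      ; ∙-congˡ to ⋆-congˡ; ∙-congʳ to ⋆-congʳ)
  open CommSemigroupProperties (CommutativeMonoid.commutativeSemigroup ⋆-commutativeMonoid) public
    using () renaming (interchange to ⋆-interchange)
  open ListProduct ⋆-commutativeMonoid public

  -- revLin a = 1 − a z, the reversal of the linear factor lin a = z − a.
  revLin : Carrier → Series
  revLin a zero          = 1#
  revLin a (suc zero)    = - a
  revLin a (suc (suc n)) = 0#

  revLin-cong : ∀ {a b} → a ≈ b → revLin a ≋ revLin b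
  revLin-cong a≈b = coeffwise λ where
    zero          → refl
    (suc zero)    → -‿cong a≈b
    (suc (suc n)) → refl

  revLin-⋆-zero : ∀ a g → (revLin a ⋆ g) 0 ≈ g 0
  revLin-⋆-zero a g = *-identityˡ (g 0)

  revLin-⋆-suc : ∀ a g j → (revLin a ⋆ g) (suc j) ≈ g (suc j) + (- a) * g j
  revLin-⋆-suc a g zero    = +-congʳ (*-identityˡ _)
  revLin-⋆-suc a g (suc j) = begin
    (revLin a ⋆ g) (suc (suc j))
      ≈⟨ sumTo-unfoldˡ (suc j) _ ⟩
    1# * g (suc (suc j)) + sumTo (suc j) (λ i → revLin a (suc i) * g (suc j ∸ i))
      ≈⟨ +-cong (*-identityˡ _) (sumTo-unfoldˡ j _) ⟩
    g (suc (suc j)) + ((- a) * g (suc j) + sumTo j (λ i → 0# * g (j ∸ i)))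
      ≈⟨ +-congˡ (trans (+-congˡ (sumTo-zero j (λ i _ → zeroˡ _))) (+-identityʳ _)) ⟩
    g (suc (suc j)) + (- a) * g (suc j)
      ∎
    where open ≈-Reasoning setoid

  revProd : List Carrier → Series
  revProd as = ∏ (map revLin as)

  revProd-↭ : ∀ {as bs} → as ↭ᴿ bs → revProd as ≋ revProd bs
  revProd-↭ as↭bs = ∏-↭ (SetoidPermutationProperties.map⁺ setoid ≋-setoid revLin-cong as↭bs)

  revProd-++ : ∀ as bs → revProd (as ++ bs) ≋ revProd as ⋆ revProd bs
  revProd-++ as bs rewrite List.map-++ revLin as bs = ∏-++ (map revLin as) (map revLin bs)

  revProd-∷ʳ : ∀ as a → revProd (as ∷ʳ a) ≋ revProd as ⋆ revLin a
  revProd-∷ʳ as a rewrite List.map-++ revLin as (a ∷ []) = ∏-∷ʳ (map revLin as) (revLin a)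

  revProd-zero : ∀ as → revProd as 0 ≈ 1#
  revProd-zero []       = refl
  revProd-zero (a ∷ as) = trans (revLin-⋆-zero a (revProd as)) (revProd-zero as)

  revProd-beyond : ∀ as n → length as < n → revProd as n ≈ 0#
  revProd-beyond []       (suc n) _            = refl
  revProd-beyond (a ∷ as) (suc n) (s≤s |as|<n) = begin
    (revLin a ⋆ revProd as) (suc n)
      ≈⟨ revLin-⋆-suc a (revProd as) n ⟩
    revProd as (suc n) + (- a) * revProd as n
      ≈⟨ +-cong (revProd-beyond as (suc n) (ℕ.m≤n⇒m≤1+n |as|<n)) (*-congˡ (revProd-beyond as n |as|<n)) ⟩
    0# + (- a) * 0#
      ≈⟨ trans (+-identityˡ _) (zeroʳ _) ⟩
    0#
      ∎
    where open ≈-Reasoning setoid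

  geom : Carrier → Series
  geom = pow

  revLin-⋆-geom : ∀ a → revLin a ⋆ geom a ≋ 𝟙
  revLin-⋆-geom a = coeffwise coeff
    where
    open ≈-Reasoning setoid
    coeff : ∀ n → (revLin a ⋆ geom a) n ≈ 𝟙 n
    coeff zero    = *-identityˡ 1#
    coeff (suc j) = begin
      (revLin a ⋆ geom a) (suc j)    ≈⟨ revLin-⋆-suc a (geom a) j ⟩
      a * pow a j + (- a) * pow a j  ≈⟨ distribʳ _ _ _ ⟨
      (a + - a) * pow a j            ≈⟨ *-congʳ (-‿inverseʳ a) ⟩
      0# * pow a j                   ≈⟨ zeroˡ _ ⟩
      0#                             ∎

  hSeries : List Carrier → Series
  hSeries as r = H r as

  revProd-⋆-hSeries : ∀ as → revProd as ⋆ hSeries as ≋ 𝟙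
  revProd-⋆-hSeries []       = ≋-trans (⋆-identityˡ (hSeries [])) (coeffwise λ where zero → refl ; (suc r) → refl)
  revProd-⋆-hSeries (a ∷ as) = begin
    (revLin a ⋆ revProd as) ⋆ hSeries (a ∷ as)      ≈⟨ ⋆-congˡ {revLin a ⋆ revProd as} hSeries-∷ ⟩
    (revLin a ⋆ revProd as) ⋆ (geom a ⋆ hSeries as) ≈⟨ ⋆-interchange (revLin a) (revProd as) (geom a) (hSeries as) ⟩
    (revLin a ⋆ geom a) ⋆ (revProd as ⋆ hSeries as) ≈⟨ ⋆-cong (revLin-⋆-geom a) (revProd-⋆-hSeries as) ⟩
    𝟙 ⋆ 𝟙                                           ≈⟨ ⋆-identityˡ 𝟙 ⟩
    𝟙                                               ∎
    where
    open ≈-Reasoning ≋-setoid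
    hSeries-∷ : hSeries (a ∷ as) ≋ geom a ⋆ hSeries as
    hSeries-∷ = coeffwise λ where zero → refl ; (suc r) → refl

module Reversal {c ℓ : Level} (R : CommutativeRing c ℓ) where
  open CommutativeRing R
  open Cyc R using (_+P_; scale; _*P_; prodP; coeff; lin)
  open PowerSeries R
  open ≈-Reasoning setoid

  coeff-+P : ∀ P Q i → coeff (P +P Q) i ≈ coeff P i + coeff Q i
  coeff-+P []      Q       i       = sym (+-identityˡ _)
  coeff-+P (a ∷ P) []      i       = sym (+-identityʳ _)
  coeff-+P (a ∷ P) (b ∷ Q) zero    = refl
  coeff-+P (a ∷ P) (b ∷ Q) (suc i) = coeff-+P P Q i

  coeff-scale : ∀ a Q i → coeff (scale a Q) i ≈ a * coeff Q i
  coeff-scale a []      i       = sym (zeroʳ a)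
  coeff-scale a (b ∷ Q) zero    = refl
  coeff-scale a (b ∷ Q) (suc i) = coeff-scale a Q i

  coeff-lin-*P-zero : ∀ r Q → coeff (lin r *P Q) 0 ≈ (- r) * coeff Q 0
  coeff-lin-*P-zero r Q = begin
    coeff (scale (- r) Q +P (0# ∷ (scale 1# Q +P (0# ∷ [])))) 0  ≈⟨ coeff-+P (scale (- r) Q) _ 0 ⟩
    coeff (scale (- r) Q) 0 + 0#                                  ≈⟨ +-identityʳ _ ⟩
    coeff (scale (- r) Q) 0                                       ≈⟨ coeff-scale (- r) Q 0 ⟩
    (- r) * coeff Q 0                                             ∎

  coeff-lin-*P-suc : ∀ r Q i → coeff (lin r *P Q) (suc i) ≈ (- r) * coeff Q (suc i) + coeff Q i
  coeff-lin-*P-suc r Q i = begin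
    coeff (scale (- r) Q +P (0# ∷ (scale 1# Q +P (0# ∷ [])))) (suc i)
      ≈⟨ coeff-+P (scale (- r) Q) _ (suc i) ⟩
    coeff (scale (- r) Q) (suc i) + coeff (scale 1# Q +P (0# ∷ [])) i
      ≈⟨ +-cong (coeff-scale (- r) Q (suc i)) (coeff-+P (scale 1# Q) _ i) ⟩
    (- r) * coeff Q (suc i) + (coeff (scale 1# Q) i + coeff (0# ∷ []) i)
      ≈⟨ +-congˡ (+-cong (trans (coeff-scale 1# Q i) (*-identityˡ _)) (coeff-0#∷[] i)) ⟩
    (- r) * coeff Q (suc i) + (coeff Q i + 0#)
      ≈⟨ +-congˡ (+-identityʳ _) ⟩
    (- r) * coeff Q (suc i) + coeff Q i
      ∎
    where
    coeff-0#∷[] : ∀ i → coeff (0# ∷ []) i ≈ 0#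
    coeff-0#∷[] zero    = refl
    coeff-0#∷[] (suc i) = refl

  coeff-∏lin-beyond : ∀ rs j → length rs < j → coeff (prodP (map lin rs)) j ≈ 0#
  coeff-∏lin-beyond []       (suc zero)    _            = refl
  coeff-∏lin-beyond []       (suc (suc j)) _            = refl
  coeff-∏lin-beyond (r ∷ rs) (suc j)       (s≤s |rs|<j) = begin
    coeff (lin r *P prodP (map lin rs)) (suc j)
      ≈⟨ coeff-lin-*P-suc r (prodP (map lin rs)) j ⟩
    (- r) * coeff (prodP (map lin rs)) (suc j) + coeff (prodP (map lin rs)) j
      ≈⟨ +-cong (*-congˡ (coeff-∏lin-beyond rs (suc j) (ℕ.m≤n⇒m≤1+n |rs|<j))) (coeff-∏lin-beyond rs j |rs|<j) ⟩
    (- r) * 0# + 0#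
      ≈⟨ trans (+-identityʳ _) (zeroʳ _) ⟩
    0#
      ∎

  -- ∏ (z − r) = z^n ∏ (1 − r z⁻¹), with n the number of roots r
  coeff-∏lin≈revProd : ∀ rs j k → j ℕ.+ k ≡ length rs → coeff (prodP (map lin rs)) j ≈ revProd rs k
  coeff-∏lin≈revProd []       zero    zero    _  = refl
  coeff-∏lin≈revProd (r ∷ rs) zero    (suc k) eq = begin
    coeff (lin r *P prodP (map lin rs)) 0
      ≈⟨ coeff-lin-*P-zero r (prodP (map lin rs)) ⟩
    (- r) * coeff (prodP (map lin rs)) 0
      ≈⟨ *-congˡ (coeff-∏lin≈revProd rs 0 k (ℕ.suc-injective eq)) ⟩
    (- r) * revProd rs k
      ≈⟨ +-identityˡ _ ⟨
    0# + (- r) * revProd rs k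
      ≈⟨ +-congʳ (revProd-beyond rs (suc k) (ℕ.≤-reflexive (≡.cong suc (≡.sym (ℕ.suc-injective eq))))) ⟨
    revProd rs (suc k) + (- r) * revProd rs k
      ≈⟨ revLin-⋆-suc r (revProd rs) k ⟨
    revProd (r ∷ rs) (suc k)
      ∎
  coeff-∏lin≈revProd (r ∷ rs) (suc j) zero    eq = begin
    coeff (lin r *P prodP (map lin rs)) (suc j)
      ≈⟨ coeff-lin-*P-suc r (prodP (map lin rs)) j ⟩
    (- r) * coeff (prodP (map lin rs)) (suc j) + coeff (prodP (map lin rs)) j
      ≈⟨ +-cong (*-congˡ (coeff-∏lin-beyond rs (suc j) (ℕ.≤-reflexive (≡.cong suc (≡.sym j≡|rs|)))))
                (coeff-∏lin≈revProd rs j 0 (≡.trans (ℕ.+-identityʳ j) j≡|rs|)) ⟩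
    (- r) * 0# + revProd rs 0
      ≈⟨ trans (+-congʳ (zeroʳ _)) (+-identityˡ _) ⟩
    revProd rs 0
      ≈⟨ revLin-⋆-zero r (revProd rs) ⟨
    revProd (r ∷ rs) 0
      ∎
    where
    j≡|rs| : j ≡ length rs
    j≡|rs| = ≡.trans (≡.sym (ℕ.+-identityʳ j)) (ℕ.suc-injective eq)
  coeff-∏lin≈revProd (r ∷ rs) (suc j) (suc k) eq = begin
    coeff (lin r *P prodP (map lin rs)) (suc j)
      ≈⟨ coeff-lin-*P-suc r (prodP (map lin rs)) j ⟩
    (- r) * coeff (prodP (map lin rs)) (suc j) + coeff (prodP (map lin rs)) j
      ≈⟨ +-cong (*-congˡ (coeff-∏lin≈revProd rs (suc j) k (≡.trans (≡.sym (ℕ.+-suc j k)) (ℕ.suc-injective eq))))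
                (coeff-∏lin≈revProd rs j (suc k) (ℕ.suc-injective eq)) ⟩
    (- r) * revProd rs k + revProd rs (suc k)
      ≈⟨ +-comm _ _ ⟩
    revProd rs (suc k) + (- r) * revProd rs k
      ≈⟨ revLin-⋆-suc r (revProd rs) k ⟨
    revProd (r ∷ rs) (suc k)
      ∎

  coeff-∏lin-reverse : ∀ rs k → k ≤ length rs → coeff (prodP (map lin rs)) (length rs ∸ k) ≈ revProd rs k
  coeff-∏lin-reverse rs k k≤|rs| = coeff-∏lin≈revProd rs (length rs ∸ k) k (ℕ.m∸n+n≡m k≤|rs|)

module Powers {c ℓ : Level} (R : CommutativeRing c ℓ) where
  open CommutativeRing R
  open Cyc R using (pow)
  open SemiringExp semiring using (_^_; ^-homo-*; ^-assocʳ)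

  pow≡^ : ∀ x n → pow x n ≡ x ^ n
  pow≡^ x zero    = ≡.refl
  pow≡^ x (suc n) = ≡.cong (x *_) (pow≡^ x n)

  pow-+ : ∀ x i j → pow x (i ℕ.+ j) ≈ pow x i * pow x j
  pow-+ x i j rewrite pow≡^ x (i ℕ.+ j) | pow≡^ x i | pow≡^ x j = ^-homo-* x i j

  pow-* : ∀ x i j → pow x (i ℕ.* j) ≈ pow (pow x j) i
  pow-* x i j rewrite ℕ.*-comm i j | pow≡^ (pow x j) i | pow≡^ x j | pow≡^ x (j ℕ.* i) = sym (^-assocʳ x j i)

module Rescaling {c ℓ : Level} (R : CommutativeRing c ℓ) where
  open CommutativeRing R
  open Cyc R using (pow; sumTo)
  open PowerSeries R
  open FiniteSums R
  open Powers R
  open CommSemigroupProperties *-commutativeSemigroup using (interchange)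
  open RingProperties ring using (-‿distribʳ-*)

  rescale : Carrier → Series → Series
  rescale x f n = pow x n * f n

  rescale-cong : ∀ x {f g} → f ≋ g → rescale x f ≋ rescale x g
  rescale-cong x f≋g = coeffwise λ n → *-congˡ (f≋g .coeff-≈ n)

  rescale-𝟙 : ∀ x → rescale x 𝟙 ≋ 𝟙
  rescale-𝟙 x = coeffwise λ where
    zero    → *-identityˡ 1#
    (suc n) → zeroʳ _

  rescale-⋆ : ∀ x f g → rescale x (f ⋆ g) ≋ rescale x f ⋆ rescale x g
  rescale-⋆ x f g = coeffwise λ n → begin
    pow x n * sumTo n (λ i → f i * g (n ∸ i))                       ≈⟨ sumTo-*ˡ n _ _ ⟨
    sumTo n (λ i → pow x n * (f i * g (n ∸ i)))                     ≈⟨ sumTo-cong n (split n) ⟩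
    sumTo n (λ i → (pow x i * f i) * (pow x (n ∸ i) * g (n ∸ i)))   ∎
    where
    open ≈-Reasoning setoid
    split : ∀ n i → i ≤ n → pow x n * (f i * g (n ∸ i)) ≈ (pow x i * f i) * (pow x (n ∸ i) * g (n ∸ i))
    split n i i≤n = begin
      pow x n * (f i * g (n ∸ i))                       ≡⟨ ≡.cong (λ k → pow x k * (f i * g (n ∸ i))) (ℕ.m+[n∸m]≡n i≤n) ⟨
      pow x (i ℕ.+ (n ∸ i)) * (f i * g (n ∸ i))         ≈⟨ *-congʳ (pow-+ x i (n ∸ i)) ⟩
      (pow x i * pow x (n ∸ i)) * (f i * g (n ∸ i))     ≈⟨ interchange _ _ _ _ ⟩
      (pow x i * f i) * (pow x (n ∸ i) * g (n ∸ i))     ∎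

  rescale-revLin : ∀ x a → rescale x (revLin a) ≋ revLin (x * a)
  rescale-revLin x a = coeffwise λ where
    zero          → *-identityˡ 1#
    (suc zero)    → trans (*-congʳ (*-identityʳ x)) (sym (-‿distribʳ-* x a))
    (suc (suc n)) → zeroʳ _

  rescale-revProd : ∀ x as → rescale x (revProd as) ≋ revProd (map (x *_) as)
  rescale-revProd x as = begin
    rescale x (∏ (map revLin as))                 ≈⟨ ∏-homo (rescale x) (rescale-𝟙 x) (rescale-⋆ x) (map revLin as) ⟩
    ∏ (map (rescale x) (map revLin as))           ≡⟨ ≡.cong ∏ (List.map-∘ as) ⟨
    ∏ (map (λ a → rescale x (revLin a)) as)       ≈⟨ ∏-map-cong (rescale-revLin x) as ⟩
    ∏ (map (λ a → revLin (x * a)) as)             ≡⟨ ≡.cong ∏ (List.map-∘ as) ⟩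
    ∏ (map revLin (map (x *_) as))                ∎
    where open ≈-Reasoning ≋-setoid

module Dilation {c ℓ : Level} (R : CommutativeRing c ℓ) (p : ℕ) .{{_ : NonZero p}} where
  open CommutativeRing R
  open Cyc R using (pow; sumTo)
  open PowerSeries R
  open FiniteSums R
  open Powers R
  open Rescaling R
  open ≈-Reasoning setoid

  -- f(z) ↦ f(z^p)
  dilate : Series → Series
  dilate f n with p ∣? n
  ... | yes _ = f (n / p)
  ... | no  _ = 0#

  dilate-cong : ∀ {f g} → f ≋ g → dilate f ≋ dilate g
  dilate-cong {f} {g} f≋g = coeffwise coeff
    where
    coeff : ∀ n → dilate f n ≈ dilate g n
    coeff n with p ∣? n
    ... | yes _ = f≋g .coeff-≈ (n / p)
    ... | no  _ = refl

  dilate-∣ : ∀ f {n} → p ∣ n → dilate f n ≈ f (n / p)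
  dilate-∣ f {n} p∣n with p ∣? n
  ... | yes _  = refl
  ... | no p∤n = ⊥-elim (p∤n p∣n)

  dilate-∤ : ∀ f {n} → ¬ p ∣ n → dilate f n ≈ 0#
  dilate-∤ f {n} p∤n with p ∣? n
  ... | yes p∣n = ⊥-elim (p∤n p∣n)
  ... | no  _   = refl

  dilate-*p : ∀ f s → dilate f (s ℕ.* p) ≈ f s
  dilate-*p f s = trans (dilate-∣ f (n∣m*n s)) (reflexive (≡.cong f (m*n/n≡m s p)))

  sumTo-dilate : ∀ (f G : Series) N → sumTo N (λ i → dilate f i * G i) ≈ sumTo (N / p) (λ s → f s * G (s ℕ.* p))
  sumTo-dilate f G N = begin
    sumTo N F                                  ≡⟨ ≡.cong (λ n → sumTo n F) (≡.trans (m≡m%n+[m/n]*n N p) (ℕ.+-comm (N % p) _)) ⟩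
    sumTo (N / p ℕ.* p ℕ.+ N % p) F            ≈⟨ block (N / p) (N % p) (m%n<n N p) ⟩
    sumTo (N / p) (λ s → f s * G (s ℕ.* p))    ∎
    where
    F : ℕ → Carrier
    F i = dilate f i * G i
    block : ∀ s r → r < p → sumTo (s ℕ.* p ℕ.+ r) F ≈ sumTo s (λ s′ → f s′ * G (s′ ℕ.* p))
    block zero    zero    _   = *-congʳ (dilate-*p f 0)
    block (suc s) zero    _   = begin
      sumTo (suc s ℕ.* p ℕ.+ 0) F
        ≡⟨ ≡.cong (λ n → sumTo n F) next-block ⟩
      sumTo (s ℕ.* p ℕ.+ ℕ.pred p) F + F (suc (s ℕ.* p ℕ.+ ℕ.pred p))
        ≈⟨ +-cong (block s (ℕ.pred p) (ℕ.≤-reflexive (ℕ.suc-pred p))) multiple ⟩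
      sumTo s (λ s′ → f s′ * G (s′ ℕ.* p)) + f (suc s) * G (suc s ℕ.* p)
        ∎
      where
      next-block : suc s ℕ.* p ℕ.+ 0 ≡ suc (s ℕ.* p ℕ.+ ℕ.pred p)
      next-block = ≡.trans (ℕ.+-identityʳ _) (≡.trans (ℕ.+-comm p (s ℕ.* p))
                     (≡.trans (≡.cong (s ℕ.* p ℕ.+_) (≡.sym (ℕ.suc-pred p))) (ℕ.+-suc _ _)))
      multiple : F (suc (s ℕ.* p ℕ.+ ℕ.pred p)) ≈ f (suc s) * G (suc s ℕ.* p)
      multiple = begin
        F (suc (s ℕ.* p ℕ.+ ℕ.pred p))  ≡⟨ ≡.cong F (≡.trans (≡.sym next-block) (ℕ.+-identityʳ _)) ⟩
        F (suc s ℕ.* p)                 ≈⟨ *-congʳ (dilate-*p f (suc s)) ⟩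
        f (suc s) * G (suc s ℕ.* p)     ∎
    block s       (suc r) r<p = begin
      sumTo (s ℕ.* p ℕ.+ suc r) F                      ≡⟨ ≡.cong (λ n → sumTo n F) (ℕ.+-suc (s ℕ.* p) r) ⟩
      sumTo (s ℕ.* p ℕ.+ r) F + F (suc (s ℕ.* p ℕ.+ r)) ≈⟨ +-cong (block s r (ℕ.<-trans (ℕ.n<1+n r) r<p)) off-multiple ⟩
      sumTo s (λ s′ → f s′ * G (s′ ℕ.* p)) + 0#          ≈⟨ +-identityʳ _ ⟩
      sumTo s (λ s′ → f s′ * G (s′ ℕ.* p))               ∎
      where
      p∤ : ¬ p ∣ s ℕ.* p ℕ.+ suc r
      p∤ p∣ = ℕ.<⇒≱ r<p (∣⇒≤ (∣m+n∣m⇒∣n p∣ (n∣m*n s)))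
      off-multiple : F (suc (s ℕ.* p ℕ.+ r)) ≈ 0#
      off-multiple rewrite ≡.sym (ℕ.+-suc (s ℕ.* p) r) = trans (*-congʳ (dilate-∤ f p∤)) (zeroˡ _)

  dilate-⋆ : ∀ f g → dilate (f ⋆ g) ≋ dilate f ⋆ dilate g
  dilate-⋆ f g = coeffwise coeff
    where
    coeff : ∀ n → dilate (f ⋆ g) n ≈ (dilate f ⋆ dilate g) n
    coeff n with p ∣? n
    ... | yes p∣n = sym (begin
        sumTo n (λ i → dilate f i * dilate g (n ∸ i))
          ≈⟨ sumTo-dilate f (λ i → dilate g (n ∸ i)) n ⟩
        sumTo (n / p) (λ s → f s * dilate g (n ∸ s ℕ.* p))
          ≈⟨ sumTo-cong (n / p) (λ s _ → *-congˡ (trans (reflexive (≡.cong (dilate g) (n∸sp s))) (dilate-*p g (n / p ∸ s)))) ⟩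
        sumTo (n / p) (λ s → f s * g (n / p ∸ s))
          ∎)
      where
      n∸sp : ∀ s → n ∸ s ℕ.* p ≡ (n / p ∸ s) ℕ.* p
      n∸sp s = ≡.trans (≡.cong (_∸ s ℕ.* p) (≡.sym (m/n*n≡m p∣n))) (≡.sym (ℕ.*-distribʳ-∸ p (n / p) s))
    ... | no p∤n = sym (begin
        sumTo n (λ i → dilate f i * dilate g (n ∸ i))
          ≈⟨ sumTo-dilate f (λ i → dilate g (n ∸ i)) n ⟩
        sumTo (n / p) (λ s → f s * dilate g (n ∸ s ℕ.* p))
          ≈⟨ sumTo-zero (n / p) (λ s s≤ → trans (*-congˡ (dilate-∤ g (p∤n∸sp s s≤))) (zeroʳ _)) ⟩
        0#
          ∎)
      where
      p∤n∸sp : ∀ s → s ≤ n / p → ¬ p ∣ n ∸ s ℕ.* p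
      p∤n∸sp s s≤n/p p∣ = p∤n (∣m∸n∣n⇒∣m p (ℕ.≤-trans (ℕ.*-monoˡ-≤ p s≤n/p) (m/n*n≤m n p)) p∣ (n∣m*n s))

  dilate-𝟙 : dilate 𝟙 ≋ 𝟙
  dilate-𝟙 = coeffwise coeff
    where
    coeff : ∀ n → dilate 𝟙 n ≈ 𝟙 n
    coeff zero    = dilate-*p 𝟙 0
    coeff (suc n) with p ∣? suc n
    ... | no _    = refl
    ... | yes p∣n with suc n / p in eq
    ...   | zero  = ⊥-elim (ℕ.<⇒≢ (m≥n⇒m/n>0 (∣⇒≤ p∣n)) (≡.sym eq))
    ...   | suc _ = refl

  dilate-revLin-beyond : ∀ a n → p < n → dilate (revLin a) n ≈ 0#
  dilate-revLin-beyond a n p<n with p ∣? n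
  ... | no _    = refl
  ... | yes p∣n = revLin-vanishes (n / p) 2≤n/p
    where
    revLin-vanishes : ∀ k → 2 ≤ k → revLin a k ≈ 0#
    revLin-vanishes (suc zero)    (s≤s ())
    revLin-vanishes (suc (suc k)) _ = refl
    2≤n/p : 2 ≤ n / p
    2≤n/p = ℕ.*-cancelʳ-< p 1 (n / p) (ℕ.≤-<-trans (ℕ.≤-reflexive (ℕ.*-identityˡ p)) (ℕ.<-≤-trans p<n (ℕ.≤-reflexive (≡.sym (m/n*n≡m p∣n)))))

  rescale-dilate : ∀ x f → rescale x (dilate f) ≋ dilate (rescale (pow x p) f)
  rescale-dilate x f = coeffwise coeff
    where
    coeff : ∀ n → rescale x (dilate f) n ≈ dilate (rescale (pow x p) f) n
    coeff n with p ∣? n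
    ... | yes p∣n = *-congʳ (trans (reflexive (≡.cong (pow x) (≡.sym (m/n*n≡m p∣n)))) (pow-* x (n / p) p))
    ... | no  _   = zeroʳ _

module RootsOfUnity {c ℓ : Level} (R : CommutativeRing c ℓ) where
  open CommutativeRing R
  open Cyc R using (pow; IsCharZeroField)
  open PowerSeries R
  open Rescaling R
  open RingProperties ring using (-1*x≈-x)
  open GroupProperties +-group using (x∙y⁻¹≈ε⇒x≈y)
  open SetoidPermutation setoid using (_↭_; ↭-sym; ↭-trans; prep; ↭-refl)
  open SetoidPermutationProperties setoid using (∷↭∷ʳ)
  open ≈-Reasoning setoid

  NoZeroDivisors : Set (c Level.⊔ ℓ)
  NoZeroDivisors = ∀ {x y} → ¬ x ≈ 0# → x * y ≈ 0# → y ≈ 0#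

  isCharZeroField⇒noZeroDivisors : IsCharZeroField → NoZeroDivisors
  isCharZeroField⇒noZeroDivisors F {x} {y} x≉0 xy≈0 with IsCharZeroField.inverse F x x≉0
  ... | x⁻¹ , xx⁻¹≈1 = begin
    y               ≈⟨ *-identityˡ y ⟨
    1# * y          ≈⟨ *-congʳ (trans (sym xx⁻¹≈1) (*-comm x x⁻¹)) ⟩
    (x⁻¹ * x) * y   ≈⟨ *-assoc x⁻¹ x y ⟩
    x⁻¹ * (x * y)   ≈⟨ *-congˡ xy≈0 ⟩
    x⁻¹ * 0#        ≈⟨ zeroʳ x⁻¹ ⟩
    0#              ∎

  fixed-by-≉1⇒≈0 : NoZeroDivisors → ∀ {y x} → ¬ y ≈ 1# → y * x ≈ x → x ≈ 0#
  fixed-by-≉1⇒≈0 noZeroDivisors {y} {x} y≉1 yx≈x = noZeroDivisors y-1≉0 (begin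
    (y - 1#) * x          ≈⟨ distribʳ x y (- 1#) ⟩
    y * x + (- 1#) * x    ≈⟨ +-cong yx≈x (-1*x≈-x x) ⟩
    x - x                 ≈⟨ -‿inverseʳ x ⟩
    0#                    ∎)
    where
    y-1≉0 : ¬ y - 1# ≈ 0#
    y-1≉0 y-1≈0 = y≉1 (x∙y⁻¹≈ε⇒x≈y y 1# y-1≈0)

  module PrimitiveRootPowers (noZeroDivisors : NoZeroDivisors) (q : ℕ) (η : Carrier) (η^[1+q]≈1 : pow η (suc q) ≈ 1#)
                             (η^t≉1 : ∀ t → 1 ≤ t → t ≤ q → ¬ pow η t ≈ 1#) where
    open Dilation R (suc q)

    powers : List Carrier
    powers = applyUpTo (pow η) (suc q)

    nontrivialPowers : List Carrier
    nontrivialPowers = applyUpTo (pow η ∘ suc) q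

    rescale-η-powers : rescale η (revProd powers) ≋ revProd powers
    rescale-η-powers = ≋-trans (rescale-revProd η powers) (≋-trans (≋-reflexive (≡.cong revProd shifted)) (revProd-↭ rotate))
      where
      shifted : map (η *_) powers ≡ nontrivialPowers ∷ʳ pow η (suc q)
      shifted = ≡.trans (List.map-applyUpTo (pow η) (η *_) (suc q)) (≡.sym (List.applyUpTo-∷ʳ (pow η ∘ suc) q))
      rotate : nontrivialPowers ∷ʳ pow η (suc q) ↭ powers
      rotate = ↭-trans (↭-sym (∷↭∷ʳ (pow η (suc q)) nontrivialPowers)) (prep η^[1+q]≈1 ↭-refl)

    revProd-powers-interior : ∀ j → 1 ≤ j → j ≤ q → revProd powers j ≈ 0#
    revProd-powers-interior j 1≤j j≤q = fixed-by-≉1⇒≈0 noZeroDivisors (η^t≉1 j 1≤j j≤q) (rescale-η-powers .coeff-≈ j)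

    -- powers = 1 ∷ nontrivialPowers, so revProd powers (j + 1) is a difference of consecutive coefficients
    revProd-nontrivialPowers : ∀ j → j ≤ q → revProd nontrivialPowers j ≈ 1#
    revProd-nontrivialPowers zero    _     = revProd-zero nontrivialPowers
    revProd-nontrivialPowers (suc j) 1+j≤q = begin
      revProd nontrivialPowers (suc j)  ≈⟨ x∙y⁻¹≈ε⇒x≈y _ _ difference≈0 ⟩
      revProd nontrivialPowers j        ≈⟨ revProd-nontrivialPowers j (ℕ.<⇒≤ 1+j≤q) ⟩
      1#                                ∎
      where
      difference≈0 : revProd nontrivialPowers (suc j) - revProd nontrivialPowers j ≈ 0#
      difference≈0 = begin
        revProd nontrivialPowers (suc j) - revProd nontrivialPowers j
          ≈⟨ +-congˡ (-1*x≈-x _) ⟨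
        revProd nontrivialPowers (suc j) + (- 1#) * revProd nontrivialPowers j
          ≈⟨ revLin-⋆-suc 1# (revProd nontrivialPowers) j ⟨
        revProd powers (suc j)
          ≈⟨ revProd-powers-interior (suc j) (s≤s z≤n) 1+j≤q ⟩
        0#
          ∎

    revProd-powers-top : revProd powers (suc q) ≈ - 1#
    revProd-powers-top = begin
      revProd powers (suc q)
        ≈⟨ revLin-⋆-suc 1# (revProd nontrivialPowers) q ⟩
      revProd nontrivialPowers (suc q) + (- 1#) * revProd nontrivialPowers q
        ≈⟨ +-cong (revProd-beyond nontrivialPowers (suc q) |nontrivialPowers|<1+q) (*-congˡ (revProd-nontrivialPowers q ℕ.≤-refl)) ⟩
      0# + (- 1#) * 1#
        ≈⟨ trans (+-identityˡ _) (*-identityʳ _) ⟩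
      - 1#
        ∎
      where
      |nontrivialPowers|<1+q : length nontrivialPowers < suc q
      |nontrivialPowers|<1+q = ℕ.≤-reflexive (≡.cong suc (List.length-applyUpTo (pow η ∘ suc) q))

    revProd-powers : revProd powers ≋ dilate (revLin 1#)
    revProd-powers = coeffwise coeff
      where
      coeff : ∀ n → revProd powers n ≈ dilate (revLin 1#) n
      coeff zero = trans (revProd-zero powers) (sym (dilate-*p (revLin 1#) 0))
      coeff (suc j) with ℕ.<-cmp j q
      ... | tri< j<q _ _ =
        trans (revProd-powers-interior (suc j) (s≤s z≤n) j<q)
              (sym (dilate-∤ (revLin 1#) (λ p∣1+j → ℕ.<⇒≱ (s≤s j<q) (∣⇒≤ p∣1+j))))
      ... | tri≈ _ ≡.refl _ =
        trans revProd-powers-top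
              (sym (trans (reflexive (≡.cong (dilate (revLin 1#)) (≡.sym (ℕ.*-identityˡ (suc q))))) (dilate-*p (revLin 1#) 1)))
      ... | tri> _ _ q<j =
        trans (revProd-beyond powers (suc j) (ℕ.≤-trans (ℕ.≤-reflexive (≡.cong suc (List.length-applyUpTo (pow η) (suc q)))) (s≤s q<j)))
              (sym (dilate-revLin-beyond 1# (suc j) (s≤s q<j)))

module Indices where
  open ≡.≡-Reasoning
  open SetoidPermutation (≡.setoid ℕ) using (_↭_; ↭-trans; ↭-reflexive)
  open SetoidPermutationProperties (≡.setoid ℕ) using (partition-↭)

  oneTo : ℕ → List ℕ
  oneTo n = map suc (upTo n)

  CoprimeTo : ℕ → Pred ℕ _
  CoprimeTo n j = Coprime j n

  coprimeTo? : ∀ n → Decidable (CoprimeTo n)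
  coprimeTo? n j = coprime? j n

  oneTo-+ : ∀ m n → oneTo (m ℕ.+ n) ≡ oneTo m ++ map (m ℕ.+_) (oneTo n)
  oneTo-+ m n = begin
    map suc (upTo (m ℕ.+ n))                                 ≡⟨ List.map-upTo suc (m ℕ.+ n) ⟩
    applyUpTo suc (m ℕ.+ n)                                  ≡⟨ applyUpTo-++ suc m n ⟩
    applyUpTo suc m ++ applyUpTo (λ i → suc (m ℕ.+ i)) n     ≡⟨ ≡.cong₂ _++_ (≡.sym (List.map-upTo suc m)) shifted ⟩
    oneTo m ++ map (m ℕ.+_) (oneTo n)                        ∎
    where
    shifted : applyUpTo (λ i → suc (m ℕ.+ i)) n ≡ map (m ℕ.+_) (oneTo n)
    shifted = ≡.trans (Pointwise.Pointwise-≡⇒≡ (applyUpTo-pointwise (λ i → ≡.sym (ℕ.+-suc m i)) n))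
                      (≡.trans (≡.sym (List.map-upTo (λ i → m ℕ.+ suc i) n)) (List.map-∘ (upTo n)))

  oneTo-suc : ∀ n → oneTo (suc n) ≡ oneTo n ∷ʳ suc n
  oneTo-suc n = ≡.trans (≡.cong (map suc) (≡.sym (List.upTo-∷ʳ n))) (List.map-++ suc (upTo n) (n ∷ []))

  module _ {p} {P : Pred ℕ p} (P? : Decidable P) (n : ℕ) (periodic : ∀ k → P ∘ (k ℕ.* n ℕ.+_) ≐ P) where

    filter-oneTo-periodic : ∀ t → filter P? (oneTo (suc t ℕ.* n)) ≡ filter P? (oneTo (t ℕ.* n)) ++ map (t ℕ.* n ℕ.+_) (filter P? (oneTo n))
    filter-oneTo-periodic t = begin
      filter P? (oneTo (n ℕ.+ t ℕ.* n))
        ≡⟨ ≡.cong (filter P? ∘ oneTo) (ℕ.+-comm n (t ℕ.* n)) ⟩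
      filter P? (oneTo (t ℕ.* n ℕ.+ n))
        ≡⟨ ≡.cong (filter P?) (oneTo-+ (t ℕ.* n) n) ⟩
      filter P? (oneTo (t ℕ.* n) ++ map (t ℕ.* n ℕ.+_) (oneTo n))
        ≡⟨ List.filter-++ P? (oneTo (t ℕ.* n)) _ ⟩
      filter P? (oneTo (t ℕ.* n)) ++ filter P? (map (t ℕ.* n ℕ.+_) (oneTo n))
        ≡⟨ ≡.cong (filter P? (oneTo (t ℕ.* n)) ++_) (filter-map P? P? (t ℕ.* n ℕ.+_) (periodic t) (oneTo n)) ⟩
      filter P? (oneTo (t ℕ.* n)) ++ map (t ℕ.* n ℕ.+_) (filter P? (oneTo n))
        ∎

  ∣-periodic : ∀ d k → (d ∣_) ∘ (k ℕ.* d ℕ.+_) ≐ (d ∣_)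
  ∣-periodic d k = (λ d∣kd+j → ∣m+n∣m⇒∣n d∣kd+j (n∣m*n k)) , ∣m∣n⇒∣m+n (n∣m*n k)

  multiples-oneTo : ∀ d t → filter (suc d ∣?_) (oneTo (t ℕ.* suc d)) ≡ map (ℕ._* suc d) (oneTo t)
  multiples-oneTo d zero    = ≡.refl
  multiples-oneTo d (suc t) = begin
    filter (p ∣?_) (oneTo (suc t ℕ.* p))
      ≡⟨ filter-oneTo-periodic (p ∣?_) p (∣-periodic p) t ⟩
    filter (p ∣?_) (oneTo (t ℕ.* p)) ++ map (t ℕ.* p ℕ.+_) (filter (p ∣?_) (oneTo p))
      ≡⟨ ≡.cong₂ _++_ (multiples-oneTo d t) (≡.cong (map (t ℕ.* p ℕ.+_)) first-block) ⟩
    map (ℕ._* p) (oneTo t) ++ (t ℕ.* p ℕ.+ p ∷ [])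
      ≡⟨ ≡.cong (λ x → map (ℕ._* p) (oneTo t) ++ (x ∷ [])) (ℕ.+-comm (t ℕ.* p) p) ⟩
    map (ℕ._* p) (oneTo t) ++ map (ℕ._* p) (suc t ∷ [])
      ≡⟨ List.map-++ (ℕ._* p) (oneTo t) (suc t ∷ []) ⟨
    map (ℕ._* p) (oneTo t ∷ʳ suc t)
      ≡⟨ ≡.cong (map (ℕ._* p)) (oneTo-suc t) ⟨
    map (ℕ._* p) (oneTo (suc t))
      ∎
    where
    p : ℕ
    p = suc d
    first-block : filter (p ∣?_) (oneTo p) ≡ p ∷ []
    first-block = begin
      filter (p ∣?_) (oneTo p)
        ≡⟨ ≡.cong (filter (p ∣?_)) (oneTo-suc d) ⟩
      filter (p ∣?_) (oneTo d ∷ʳ p)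
        ≡⟨ List.filter-++ (p ∣?_) (oneTo d) (p ∷ []) ⟩
      filter (p ∣?_) (oneTo d) ++ filter (p ∣?_) (p ∷ [])
        ≡⟨ ≡.cong₂ _++_ (List.filter-none (p ∣?_) below-p) (List.filter-accept (p ∣?_) ∣-refl) ⟩
      p ∷ []
        ∎
      where
      below-p : All (∁ (p ∣_)) (oneTo d)
      below-p = All.map⁺ (All.applyUpTo⁺₁ (λ i → i) d (λ i<d p∣1+i → ℕ.<⇒≱ (s≤s i<d) (∣⇒≤ p∣1+i)))

  coprime-periodic : ∀ m k → CoprimeTo m ∘ (k ℕ.* m ℕ.+_) ≐ CoprimeTo m
  coprime-periodic m k =
    (λ coprime (i∣j , i∣m) → coprime (∣m∣n⇒∣m+n (∣n⇒∣m*n k i∣m) i∣j , i∣m)) ,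
    (λ coprime (i∣km+j , i∣m) → coprime (∣m+n∣m⇒∣n i∣km+j (∣n⇒∣m*n k i∣m) , i∣m))

  coprimeTo-oneTo-suc : ∀ m t → filter (coprimeTo? m) (oneTo (suc t ℕ.* m)) ≡
                                filter (coprimeTo? m) (oneTo (t ℕ.* m)) ++ map (t ℕ.* m ℕ.+_) (coprimeIdx m)
  coprimeTo-oneTo-suc m = filter-oneTo-periodic (coprimeTo? m) m (coprime-periodic m)

  length-coprimeTo-oneTo : ∀ m t → length (filter (coprimeTo? m) (oneTo (t ℕ.* m))) ≡ t ℕ.* φ m
  length-coprimeTo-oneTo m zero    = ≡.refl
  length-coprimeTo-oneTo m (suc t) = begin
    length (filter (coprimeTo? m) (oneTo (suc t ℕ.* m)))
      ≡⟨ ≡.cong length (coprimeTo-oneTo-suc m t) ⟩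
    length (filter (coprimeTo? m) (oneTo (t ℕ.* m)) ++ map (t ℕ.* m ℕ.+_) (coprimeIdx m))
      ≡⟨ List.length-++ (filter (coprimeTo? m) (oneTo (t ℕ.* m))) ⟩
    length (filter (coprimeTo? m) (oneTo (t ℕ.* m))) ℕ.+ length (map (t ℕ.* m ℕ.+_) (coprimeIdx m))
      ≡⟨ ≡.cong₂ ℕ._+_ (length-coprimeTo-oneTo m t) (List.length-map _ (coprimeIdx m)) ⟩
    t ℕ.* φ m ℕ.+ φ m
      ≡⟨ ℕ.+-comm (t ℕ.* φ m) (φ m) ⟩
    suc t ℕ.* φ m
      ∎

  module CoprimeToPrimeMultiple {q m : ℕ} (p-prime : Prime (suc q)) (p∤m : ¬ suc q ∣ m) where

    p : ℕ
    p = suc q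

    coprime-prime : ∀ {i} → ¬ p ∣ i → Coprime i p
    coprime-prime p∤i (e∣i , e∣p) with prime⇒irreducible p-prime e∣p
    ... | inj₁ e≡1    = e≡1
    ... | inj₂ ≡.refl = ⊥-elim (p∤i e∣i)

    coprime-*prime : CoprimeTo m ∘ (ℕ._* p) ≐ CoprimeTo m
    coprime-*prime =
      (λ coprime (i∣j , i∣m) → coprime (∣m⇒∣m*n p i∣j , i∣m)) ,
      (λ {j} coprime {i} (i∣jp , i∣m) →
         coprime (coprime-divisor (coprime-prime (λ p∣i → p∤m (∣-trans p∣i i∣m))) (≡.subst (i ∣_) (ℕ.*-comm j p) i∣jp) , i∣m))

    coprime-*prime-split : CoprimeTo (m ℕ.* p) ≐ CoprimeTo m ∩ ∁ (p ∣_)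
    coprime-*prime-split =
      (λ coprime → (λ (i∣j , i∣m) → coprime (i∣j , ∣m⇒∣m*n p i∣m)) ,
                   (λ p∣j → ℕ.nonTrivial⇒≢1 {{prime⇒nonTrivial p-prime}} (coprime (p∣j , ∣n⇒∣m*n m ∣-refl)))) ,
      (λ (coprime , p∤j) (i∣j , i∣mp) →
         coprime-prime p∤j (i∣j , coprime-divisor (λ (e∣i , e∣m) → coprime (∣-trans e∣i i∣j , e∣m)) i∣mp))

    coprimeTo-partition : filter (coprimeTo? m) (oneTo (m ℕ.* p)) ↭ map (ℕ._* p) (coprimeIdx m) ++ coprimeIdx (m ℕ.* p)
    coprimeTo-partition = ↭-trans split (↭-reflexive (≡.cong₂ _++_ multiples coprimes))
      where
      U X : List ℕ
      U = oneTo (m ℕ.* p)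
      X = filter (coprimeTo? m) U
      split : X ↭ filter (p ∣?_) X ++ filter (∁? (p ∣?_)) X
      split = ≡.subst (λ (ys , zs) → X ↭ ys ++ zs) (List.partition-defn (p ∣?_) X) (partition-↭ (p ∣?_) X)
      multiples : filter (p ∣?_) X ≡ map (ℕ._* p) (coprimeIdx m)
      multiples = begin
        filter (p ∣?_) X
          ≡⟨ filter-filter (p ∣?_) (coprimeTo? m) U ⟩
        filter (coprimeTo? m ∩? (p ∣?_)) U
          ≡⟨ List.filter-≐ _ _ (swap , swap) U ⟩
        filter ((p ∣?_) ∩? coprimeTo? m) U
          ≡⟨ filter-filter (coprimeTo? m) (p ∣?_) U ⟨
        filter (coprimeTo? m) (filter (p ∣?_) U)
          ≡⟨ ≡.cong (filter (coprimeTo? m)) (multiples-oneTo q m) ⟩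
        filter (coprimeTo? m) (map (ℕ._* p) (oneTo m))
          ≡⟨ filter-map (coprimeTo? m) (coprimeTo? m) (ℕ._* p) coprime-*prime (oneTo m) ⟩
        map (ℕ._* p) (coprimeIdx m)
          ∎
      coprimes : filter (∁? (p ∣?_)) X ≡ coprimeIdx (m ℕ.* p)
      coprimes = begin
        filter (∁? (p ∣?_)) X
          ≡⟨ filter-filter (∁? (p ∣?_)) (coprimeTo? m) U ⟩
        filter (coprimeTo? m ∩? ∁? (p ∣?_)) U
          ≡⟨ List.filter-≐ _ _ (proj₂ coprime-*prime-split , proj₁ coprime-*prime-split) U ⟩
        coprimeIdx (m ℕ.* p)
          ∎

module CyclotomicCoefficients {c ℓ : Level} (R : CommutativeRing c ℓ) (R-field : Cyc.IsCharZeroField R)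
  (q m : ℕ) (p-prime : Prime (suc q)) (1≤m : 1 ≤ m) (p∤m : ¬ suc q ∣ m)
  (ω : CommutativeRing.Carrier R) (ω-primitive : Cyc.IsPrimitiveRoot R (m ℕ.* suc q) ω) where

  open CommutativeRing R
  open Cyc R using (pow; sumTo; H; a; primRoots; coeff; prodP; lin; IsPrimitiveRoot)
  open PowerSeries R
  open FiniteSums R
  open Powers R
  open Rescaling R
  open Reversal R
  open RootsOfUnity R
  open Indices
  open CoprimeToPrimeMultiple p-prime p∤m using (coprimeTo-partition)
  open IsPrimitiveRoot ω-primitive

  p : ℕ
  p = suc q

  open Dilation R p

  ζ η : Carrier
  ζ = pow ω p
  η = pow ω m

  η^p≈1 : pow η p ≈ 1#
  η^p≈1 = trans (sym (pow-* ω p m)) (trans (reflexive (≡.cong (pow ω) (ℕ.*-comm p m))) pow-n≈1)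

  η^t≉1 : ∀ t → 1 ≤ t → t ≤ q → ¬ pow η t ≈ 1#
  η^t≉1 t 1≤t t≤q η^t≈1 = pow-d≉1 (t ℕ.* m) (ℕ.*-mono-≤ 1≤t 1≤m) tm<mp (trans (pow-* ω t m) η^t≈1)
    where
    tm<mp : t ℕ.* m < m ℕ.* p
    tm<mp = ℕ.<-≤-trans (ℕ.*-monoˡ-< m {{ℕ.>-nonZero 1≤m}} (s≤s t≤q)) (ℕ.≤-reflexive (ℕ.*-comm p m))

  open PrimitiveRootPowers (isCharZeroField⇒noZeroDivisors R-field) q η η^p≈1 η^t≉1 using (powers; revProd-powers)

  open SetoidPermutation setoid using () renaming (refl to ↭ᴿ-pointwise)

  I : List ℕ
  I = coprimeIdx m

  A B : List Carrier
  A = primRoots m ζ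
  B = primRoots (m ℕ.* p) ω

  column : ∀ i → revProd (applyUpTo (λ k → pow ω (k ℕ.* m ℕ.+ i)) p) ≋ dilate (revLin (pow ζ i))
  column i = begin
    revProd (applyUpTo (λ k → pow ω (k ℕ.* m ℕ.+ i)) p)   ≈⟨ revProd-↭ (↭ᴿ-pointwise (applyUpTo-pointwise split p)) ⟩
    revProd (applyUpTo (λ k → pow ω i * pow η k) p)       ≡⟨ ≡.cong revProd (List.map-applyUpTo (pow η) (pow ω i *_) p) ⟨
    revProd (map (pow ω i *_) powers)                     ≈⟨ rescale-revProd (pow ω i) powers ⟨
    rescale (pow ω i) (revProd powers)                    ≈⟨ rescale-cong (pow ω i) revProd-powers ⟩
    rescale (pow ω i) (dilate (revLin 1#))                ≈⟨ rescale-dilate (pow ω i) (revLin 1#) ⟩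
    dilate (rescale (pow (pow ω i) p) (revLin 1#))        ≈⟨ dilate-cong (rescale-revLin (pow (pow ω i) p) 1#) ⟩
    dilate (revLin (pow (pow ω i) p * 1#))                ≈⟨ dilate-cong (revLin-cong ω^ip≈ζ^i) ⟩
    dilate (revLin (pow ζ i))                             ∎
    where
    open ≈-Reasoning ≋-setoid
    split : ∀ k → pow ω (k ℕ.* m ℕ.+ i) ≈ pow ω i * pow η k
    split k = trans (pow-+ ω (k ℕ.* m) i) (trans (*-comm _ _) (*-congˡ (pow-* ω k m)))
    ω^ip≈ζ^i : pow (pow ω i) p * 1# ≈ pow ζ i
    ω^ip≈ζ^i = trans (*-identityʳ _) (trans (sym (pow-* ω p i)) (trans (reflexive (≡.cong (pow ω) (ℕ.*-comm p i))) (pow-* ω i p)))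

  residue-columns : ∀ t → revProd (map (pow ω) (filter (coprimeTo? m) (oneTo (t ℕ.* m)))) ≋
                          ∏ (map (λ i → revProd (applyUpTo (λ k → pow ω (k ℕ.* m ℕ.+ i)) t)) I)
  residue-columns zero    = ≋-sym (∏-map-ε I)
  residue-columns (suc t) = begin
    revProd (map (pow ω) (filter (coprimeTo? m) (oneTo (suc t ℕ.* m))))
      ≡⟨ ≡.cong (revProd ∘ map (pow ω)) (coprimeTo-oneTo-suc m t) ⟩
    revProd (map (pow ω) (C t ++ map (t ℕ.* m ℕ.+_) I))
      ≡⟨ ≡.cong revProd (List.map-++ (pow ω) (C t) _) ⟩
    revProd (map (pow ω) (C t) ++ map (pow ω) (map (t ℕ.* m ℕ.+_) I))
      ≈⟨ revProd-++ (map (pow ω) (C t)) _ ⟩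
    revProd (map (pow ω) (C t)) ⋆ ∏ (map revLin (map (pow ω) (map (t ℕ.* m ℕ.+_) I)))
      ≡⟨ ≡.cong (λ xs → revProd (map (pow ω) (C t)) ⋆ ∏ xs) (≡.trans (≡.sym (List.map-∘ _)) (≡.sym (List.map-∘ I))) ⟩
    revProd (map (pow ω) (C t)) ⋆ ∏ (map (λ i → revLin (pow ω (t ℕ.* m ℕ.+ i))) I)
      ≈⟨ ⋆-congʳ {∏ (map (λ i → revLin (pow ω (t ℕ.* m ℕ.+ i))) I)} (residue-columns t) ⟩
    ∏ (map (column-upTo t) I) ⋆ ∏ (map (λ i → revLin (pow ω (t ℕ.* m ℕ.+ i))) I)
      ≈⟨ ∏-map-∙ (column-upTo t) (λ i → revLin (pow ω (t ℕ.* m ℕ.+ i))) I ⟨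
    ∏ (map (λ i → column-upTo t i ⋆ revLin (pow ω (t ℕ.* m ℕ.+ i))) I)
      ≈⟨ ∏-map-cong extend-column I ⟩
    ∏ (map (column-upTo (suc t)) I)
      ∎
    where
    open ≈-Reasoning ≋-setoid
    C : ℕ → List ℕ
    C t = filter (coprimeTo? m) (oneTo (t ℕ.* m))
    column-upTo : ℕ → ℕ → Series
    column-upTo t i = revProd (applyUpTo (λ k → pow ω (k ℕ.* m ℕ.+ i)) t)
    extend-column : ∀ i → column-upTo t i ⋆ revLin (pow ω (t ℕ.* m ℕ.+ i)) ≋ column-upTo (suc t) i
    extend-column i = ≋-trans (≋-sym (revProd-∷ʳ (applyUpTo ω^[km+i] t) (ω^[km+i] t)))
                              (≋-reflexive (≡.cong revProd (List.applyUpTo-∷ʳ ω^[km+i] t)))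
      where
      ω^[km+i] : ℕ → Carrier
      ω^[km+i] k = pow ω (k ℕ.* m ℕ.+ i)

  revProd-coprimeTo-split : revProd (map (pow ω) (filter (coprimeTo? m) (oneTo (m ℕ.* p)))) ≋ revProd A ⋆ revProd B
  revProd-coprimeTo-split = begin
    revProd (map (pow ω) (filter (coprimeTo? m) (oneTo (m ℕ.* p))))
      ≈⟨ revProd-↭ (SetoidPermutationProperties.map⁺ (≡.setoid ℕ) setoid (reflexive ∘ ≡.cong (pow ω)) coprimeTo-partition) ⟩
    revProd (map (pow ω) (map (ℕ._* p) I ++ coprimeIdx (m ℕ.* p)))
      ≡⟨ ≡.cong revProd (List.map-++ (pow ω) (map (ℕ._* p) I) _) ⟩
    revProd (map (pow ω) (map (ℕ._* p) I) ++ B)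
      ≈⟨ revProd-↭ (↭ᴿ-pointwise (Pointwise.++⁺ ω^ip≈ζ^i (Pointwise.refl refl))) ⟩
    revProd (A ++ B)
      ≈⟨ revProd-++ A B ⟩
    revProd A ⋆ revProd B
      ∎
    where
    open ≈-Reasoning ≋-setoid
    ω^ip≈ζ^i : Pointwise _≈_ (map (pow ω) (map (ℕ._* p) I)) A
    ω^ip≈ζ^i rewrite ≡.sym (List.map-∘ {g = pow ω} {f = ℕ._* p} I) = map-pointwise (λ i → pow-* ω i p) I

  revProd-cyclotomic : revProd A ⋆ revProd B ≋ dilate (revProd A)
  revProd-cyclotomic = begin
    revProd A ⋆ revProd B
      ≈⟨ revProd-coprimeTo-split ⟨
    revProd (map (pow ω) (filter (coprimeTo? m) (oneTo (m ℕ.* p))))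
      ≡⟨ ≡.cong (λ n → revProd (map (pow ω) (filter (coprimeTo? m) (oneTo n)))) (ℕ.*-comm m p) ⟩
    revProd (map (pow ω) (filter (coprimeTo? m) (oneTo (p ℕ.* m))))
      ≈⟨ residue-columns p ⟩
    ∏ (map (λ i → revProd (applyUpTo (λ k → pow ω (k ℕ.* m ℕ.+ i)) p)) I)
      ≈⟨ ∏-map-cong column I ⟩
    ∏ (map (λ i → dilate (revLin (pow ζ i))) I)
      ≡⟨ ≡.cong ∏ (≡.trans (List.map-∘ I) (≡.cong (map dilate) (List.map-∘ I))) ⟩
    ∏ (map dilate (map revLin A))
      ≈⟨ ∏-homo dilate dilate-𝟙 dilate-⋆ (map revLin A) ⟨
    dilate (revProd A)
      ∎
    where open ≈-Reasoning ≋-setoid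

  revProd-B≋dilate⋆hSeries : revProd B ≋ dilate (revProd A) ⋆ hSeries A
  revProd-B≋dilate⋆hSeries = begin
    revProd B                                ≈⟨ ⋆-identityˡ (revProd B) ⟨
    𝟙 ⋆ revProd B                            ≈⟨ ⋆-congʳ {revProd B} (revProd-⋆-hSeries A) ⟨
    (revProd A ⋆ hSeries A) ⋆ revProd B      ≈⟨ xy∙z≈xz∙y (revProd A) (hSeries A) (revProd B) ⟩
    (revProd A ⋆ revProd B) ⋆ hSeries A      ≈⟨ ⋆-congʳ {hSeries A} revProd-cyclotomic ⟩
    dilate (revProd A) ⋆ hSeries A           ∎
    where
    open ≈-Reasoning ≋-setoid
    open CommSemigroupProperties (CommutativeMonoid.commutativeSemigroup ⋆-commutativeMonoid) using (xy∙z≈xz∙y)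

  φ[mp]≡q*φ[m] : φ (m ℕ.* p) ≡ q ℕ.* φ m
  φ[mp]≡q*φ[m] = ℕ.+-cancelˡ-≡ (φ m) _ _ (begin
    φ m ℕ.+ φ (m ℕ.* p)
      ≡⟨ ≡.cong (ℕ._+ φ (m ℕ.* p)) (List.length-map (ℕ._* p) I) ⟨
    length (map (ℕ._* p) I) ℕ.+ φ (m ℕ.* p)
      ≡⟨ List.length-++ (map (ℕ._* p) I) ⟨
    length (map (ℕ._* p) I ++ coprimeIdx (m ℕ.* p))
      ≡⟨ SetoidPermutationProperties.xs↭ys⇒|xs|≡|ys| (≡.setoid ℕ) coprimeTo-partition ⟨
    length (filter (coprimeTo? m) (oneTo (m ℕ.* p)))
      ≡⟨ ≡.cong (λ n → length (filter (coprimeTo? m) (oneTo n))) (ℕ.*-comm m p) ⟩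
    length (filter (coprimeTo? m) (oneTo (p ℕ.* m)))
      ≡⟨ length-coprimeTo-oneTo m p ⟩
    φ m ℕ.+ q ℕ.* φ m
      ∎)
    where open ≡.≡-Reasoning

  coefficient-formula : ∀ k → k ≤ q ℕ.* φ m →
    a (m ℕ.* p) ω k ≈ sumTo (k / p) (λ s → a m ζ s * H (k ∸ s ℕ.* p) A)
  coefficient-formula k k≤qφ = begin
    coeff (prodP (map lin B)) (φ (m ℕ.* p) ∸ k)             ≡⟨ ≡.cong (λ n → coeff (prodP (map lin B)) (n ∸ k)) |B|≡φ[mp] ⟨
    coeff (prodP (map lin B)) (length B ∸ k)                ≈⟨ coeff-∏lin-reverse B k k≤|B| ⟩
    revProd B k                                             ≈⟨ revProd-B≋dilate⋆hSeries .coeff-≈ k ⟩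
    sumTo k (λ i → dilate (revProd A) i * H (k ∸ i) A)      ≈⟨ sumTo-dilate (revProd A) (λ i → H (k ∸ i) A) k ⟩
    sumTo (k / p) (λ s → revProd A s * H (k ∸ s ℕ.* p) A)   ≈⟨ sumTo-cong (k / p) (λ s s≤k/p → *-congʳ (a≈revProd s s≤k/p)) ⟨
    sumTo (k / p) (λ s → a m ζ s * H (k ∸ s ℕ.* p) A)       ∎
    where
    open ≈-Reasoning setoid
    |A|≡φ[m] : length A ≡ φ m
    |A|≡φ[m] = List.length-map (pow ζ) I
    |B|≡φ[mp] : length B ≡ φ (m ℕ.* p)
    |B|≡φ[mp] = List.length-map (pow ω) (coprimeIdx (m ℕ.* p))
    k≤|B| : k ≤ length B
    k≤|B| = ≡.subst (k ≤_) (≡.sym (≡.trans |B|≡φ[mp] φ[mp]≡q*φ[m])) k≤qφ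
    k/p≤φ[m] : k / p ≤ φ m
    k/p≤φ[m] = ℕ.≤-trans (/-monoˡ-≤ p (ℕ.≤-trans k≤qφ (ℕ.m≤n+m (q ℕ.* φ m) (φ m))))
                        (ℕ.≤-reflexive (≡.trans (≡.cong (_/ p) (ℕ.*-comm p (φ m))) (m*n/n≡m (φ m) p)))
    a≈revProd : ∀ s → s ≤ k / p → a m ζ s ≈ revProd A s
    a≈revProd s s≤k/p = trans (reflexive (≡.cong (λ n → coeff (prodP (map lin A)) (n ∸ s)) (≡.sym |A|≡φ[m])))
                              (coeff-∏lin-reverse A s (ℕ.≤-trans s≤k/p (ℕ.≤-trans k/p≤φ[m] (ℕ.≤-reflexive (≡.sym |A|≡φ[m])))))

-- imported only here, since the modules above open the ring multiplication _*_
open import Data.Nat using (_*_)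

theorem1p2 : ∀ {c ℓ} (R : CommutativeRing c ℓ) → Cyc.IsCharZeroField R →
    (p m : ℕ) → .{{_ : NonZero p}} → Prime p → 1 ≤ m → ¬ (p ∣ m) →
    (ω : CommutativeRing.Carrier R) → Cyc.IsPrimitiveRoot R (m * p) ω →
    ∀ k → k ≤ (p ∸ 1) * φ m →
    CommutativeRing._≈_ R (Cyc.a R (m * p) ω k)
      (Cyc.sumTo R (k / p) (λ s → CommutativeRing._*_ R (Cyc.a R m (Cyc.pow R ω p) s)
        (Cyc.H R (k ∸ s * p) (Cyc.primRoots R m (Cyc.pow R ω p)))))
theorem1p2 R R-field zero    m p-prime = ⊥-elim (ℕ.NonZero.nonZero (prime⇒nonZero p-prime))
theorem1p2 R R-field (suc q) m p-prime 1≤m p∤m ω ω-primitive =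
  CyclotomicCoefficients.coefficient-formula R R-field q m p-prime 1≤m p∤m ω ω-primitive
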